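{- Let $n,k$ be positive integers and suppose there exists a Breaker pairing strategy for $\mathcal{Q}(n,k)$. (a) If $k\ge n/3+1$, then there exists a Breaker pairing strategy for $\mathcal{Q}(4n,4k-3)$. (b) If $k=\lfloor n/3\rfloor+1$, then there exists a Breaker pairing strategy for $\mathcal{Q}(4n,\lfloor 4n/3\rfloor+1)$.
   Context: $Q_n$ is the hypercube graph on $\{0,1\}^n$ (vertices adjacent iff they differ in exactly one coordinate). A $k$-dimensional subcube of $Q_n$ is obtained by choosing $n-k$ coordinates and fixed values in $\{0,1\}$ for them, and taking all $2^k$ vectors agreeing with these fixed values. $\mathcal{Q}(n,k)$ is the hypergraph with vertex set $\{0,1\}^n$ whose edges are the $k$-dimensional subcubes of $Q_n$ (the Maker–Breaker game is played on it). Following the paper's convention, a Breaker pairing strategy for $\mathcal{Q}(n,k)$ is a matching $M$ in $Q_n$ such that every $k$-dimensional subcube of $Q_n$ contains both endpoints of at least one edge of $M$. -}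

module Defs where

open import Data.Nat using (ℕ; zero; suc)
open import Data.Bool using (Bool)
open import Data.Maybe using (Maybe; just; nothing)
open import Data.Vec using (Vec; []; _∷_)
open import Data.Product using (_×_; _,_; ∃-syntax)
open import Data.List using (List; concatMap; [_]; _∷_)
open import Data.List.Relation.Unary.All using (All)
open import Data.List.Relation.Unary.Any using (Any)
open import Data.List.Relation.Unary.Unique.Propositional using (Unique)
open import Relation.Binary.PropositionalEquality using (_≡_; _≢_)

Vertex : ℕ → Set
Vertex n = Vec Bool n

data Adjacent : {n : ℕ} → Vertex n → Vertex n → Set where
  here  : ∀ {n a b} {xs : Vertex n} → a ≢ b → Adjacent (a ∷ xs) (b ∷ xs)
  there : ∀ {n a} {xs ys : Vertex n} → Adjacent xs ys → Adjacent (a ∷ xs) (a ∷ ys)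

-- A subcube pattern: 'nothing' = free coordinate, 'just b' = coordinate fixed to b.
Pattern : ℕ → Set
Pattern n = Vec (Maybe Bool) n

dim : {n : ℕ} → Pattern n → ℕ
dim [] = zero
dim (nothing ∷ p) = suc (dim p)
dim (just _ ∷ p) = dim p

data _∈Cube_ : {n : ℕ} → Vertex n → Pattern n → Set where
  []     : [] ∈Cube []
  free   : ∀ {n a} {v : Vertex n} {p} → v ∈Cube p → (a ∷ v) ∈Cube (nothing ∷ p)
  fixed  : ∀ {n a} {v : Vertex n} {p} → v ∈Cube p → (a ∷ v) ∈Cube (just a ∷ p)

Edge : ℕ → Set
Edge n = Vertex n × Vertex n

endpoints : {n : ℕ} → Edge n → List (Vertex n)
endpoints (u , v) = u ∷ [ v ]

IsMatching : {n : ℕ} → List (Edge n) → Set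
IsMatching {n} M = All (λ e → Adjacent (Data.Product.proj₁ e) (Data.Product.proj₂ e)) M
                 × Unique (concatMap endpoints M)

BreakerPairing : (n k : ℕ) → List (Edge n) → Set
BreakerPairing n k M =
  IsMatching M ×
  ((p : Pattern n) → dim p ≡ k →
     Any (λ e → (Data.Product.proj₁ e ∈Cube p) × (Data.Product.proj₂ e ∈Cube p)) M)

HasBreakerPairing : (n k : ℕ) → Set
HasBreakerPairing n k = ∃[ M ] BreakerPairing n k M

module Submission where

-- Split the 4n coordinates of Q_{4n} into n blocks of four; the parities of the blocks
-- project Q_{4n} onto Q_n. A vertex is matched exactly when its projection x is: if x is
-- matched in direction j, flip the coordinate of block j that a fixed table assigns to the
-- bits of block j and to the XOR of a two-bit label over all other blocks. A flip inside
-- block j changes neither that XOR nor the projection away from coordinate j, so the flipped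
-- vertex is matched back along the same coordinate and this is a matching.
--
-- A K-dimensional subcube p of Q_{4n} has block dimensions summing to K. Since 4k ≤ K + 3
-- and n + k ≤ K, there is a k-dimensional subcube q of Q_n each of whose free coordinates
-- is a block of dimension at least 2, or of dimension at least 1 while another block has
-- dimension at least 3. The given matching has an edge in q, and it lifts to an edge in p:
-- a block of dimension at least 2 contains an edge of the table for every value of the XOR,
-- and for a block of dimension 1 the value it needs is produced by re-choosing the vertex in
-- a block of dimension at least 3, where every parity and every label occurs. These
-- properties of the table are checked by exhaustive computation on Q_4.

open import Defs
import Data.Nat.Properties as ℕ
open import Algebra.Properties.Semiring.Sum ℕ.+-*-semiring
  using (sum; sum-syntax; sum-cong-≗; ∑-comm; ∑-distrib-+; *-distribˡ-sum)
open import Data.Bool using (Bool; true; false; not; _xor_; T)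
import Data.Bool.Properties as Bool
open import Data.Empty using (⊥-elim)
open import Data.Fin using (Fin; zero; suc; combine; remQuot; _↑ˡ_; _↑ʳ_)
import Data.Fin.Properties as Fin
open import Data.Fin.Patterns using (0F; 1F; 2F; 3F)
open import Data.List using (List; []; _∷_; [_]; _++_; map; concatMap; cartesianProductWith; cartesianProduct)
open import Data.List.Properties using (concatMap-++)
open import Data.List.Membership.Propositional using (_∈_; _∉_; lose; find)
open import Data.List.Membership.Propositional.Properties
  using (∈-cartesianProductWith⁺; ∈-cartesianProduct⁺; ∈-concatMap⁺; ∈-concatMap⁻; ∈-++⁺ˡ; ∈-++⁺ʳ; ∈-map⁺)
open import Data.List.Relation.Binary.Disjoint.Propositional using (Disjoint)
open import Data.List.Relation.Unary.All as All using (All; []; _∷_)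
import Data.List.Relation.Unary.All.Properties as All
open import Data.List.Relation.Unary.AllPairs as AllPairs using ([]; _∷_)
import Data.List.Relation.Unary.AllPairs.Properties as AllPairs
open import Data.List.Relation.Unary.Any as Any using (Any; here; there)
open import Data.List.Relation.Unary.Unique.Propositional using (Unique)
import Data.List.Relation.Unary.Unique.Propositional.Properties as Unique
open import Data.Maybe using (Maybe; just; nothing; maybe′)
import Data.Maybe as Maybe
open import Data.Maybe.Properties using (just-injective)
import Data.Maybe.Relation.Unary.All as MaybeAll
open import Data.Nat using (ℕ; zero; suc; _+_; _*_; _∸_; _/_; _≤_; _≤ᵇ_; _≤?_; z≤n; s≤s; s≤s⁻¹; NonZero; >-nonZero⁻¹)
open import Data.Nat.DivMod using (m/n*n≤m; m*n/n≡m; +-distrib-/-∣ʳ)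
open import Data.Nat.Divisibility using (n∣m*n)
open import Data.Product using (_×_; _,_; proj₁; proj₂; ∃; ∃-syntax)
import Data.Product.Properties as Product
open import Data.Sum using (_⊎_; inj₁; inj₂)
open import Data.Unit using (tt)
open import Data.Vec using (Vec; []; _∷_; lookup; tabulate; _[_]%=_; _[_]≔_)
import Data.Vec.Properties as Vec
open import Data.Vec.Functional using (updateAt)
import Data.Vec.Functional.Properties as VecF
open import Function using (_∘_; const)
open import Relation.Binary.PropositionalEquality
  using (_≡_; _≢_; refl; sym; trans; cong; cong₂; subst; subst₂; module ≡-Reasoning)
open import Relation.Nullary using (Dec; yes; no; map′; _×-dec_; _→-dec_; from-yes)
open import Relation.Unary using (Decidable)

private
  variable
    A B C : Set
    m n : ℕ

concatMap-concatMap : (f : B → List C) (g : A → List B) (xs : List A) →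
                      concatMap f (concatMap g xs) ≡ concatMap (concatMap f ∘ g) xs
concatMap-concatMap f g []       = refl
concatMap-concatMap f g (x ∷ xs) =
  trans (concatMap-++ f (g x) (concatMap g xs)) (cong (concatMap f (g x) ++_) (concatMap-concatMap f g xs))

++-disjoint : {xs ys : List A} {x : A} → Unique (xs ++ ys) → x ∈ xs → x ∉ ys
++-disjoint {xs = _ ∷ xs} (x∉ ∷ _)  (here refl) x∈ys = All.lookup x∉ (∈-++⁺ʳ xs x∈ys) refl
++-disjoint {xs = _ ∷ _}  (_ ∷ xs!) (there x∈)  x∈ys = ++-disjoint xs! x∈ x∈ys

lookup-extensional : {u v : Vec A n} → (∀ i → lookup u i ≡ lookup v i) → u ≡ v
lookup-extensional {u = u} {v} eq =
  trans (sym (Vec.tabulate∘lookup u)) (trans (Vec.tabulate-cong eq) (Vec.tabulate∘lookup v))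

updateAt-∀ : (Q : Fin n → A → Set) {g : Fin n → A} {i : Fin n} {x : A} →
             Q i x → (∀ i′ → i′ ≢ i → Q i′ (g i′)) → ∀ i′ → Q i′ (updateAt g i (const x) i′)
updateAt-∀ Q {g} {i} qx qg i′ with i′ Fin.≟ i
... | yes refl = subst (Q i) (sym (VecF.updateAt-updates i g)) qx
... | no i′≢i  = subst (Q i′) (sym (VecF.updateAt-minimal i′ i g i′≢i)) (qg i′ i′≢i)

∑-mono-≤ : {f g : Fin n → ℕ} → (∀ i → f i ≤ g i) → sum f ≤ sum g
∑-mono-≤ {zero}  f≤g = z≤n
∑-mono-≤ {suc n} f≤g = ℕ.+-mono-≤ (f≤g zero) (∑-mono-≤ (f≤g ∘ suc))

∑-split : ∀ a b (h : Fin (a + b) → ℕ) → sum h ≡ sum (h ∘ (_↑ˡ b)) + sum (h ∘ (a ↑ʳ_))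
∑-split zero    b h = refl
∑-split (suc a) b h = trans (cong (h zero +_) (∑-split a b (h ∘ suc))) (sym (ℕ.+-assoc (h zero) _ _))

∑-combine : ∀ m n (h : Fin (m * n) → ℕ) → sum h ≡ ∑[ c < m ] ∑[ i < n ] h (combine c i)
∑-combine zero    n h = refl
∑-combine (suc m) n h =
  trans (∑-split n (m * n) h) (cong (sum (h ∘ (_↑ˡ m * n)) +_) (∑-combine m n (h ∘ (n ↑ʳ_))))

≤-cancel-remainder : ∀ d {k c} → suc d * k ≤ suc d * c + d → k ≤ c
≤-cancel-remainder d {k} {c} le = s≤s⁻¹ (ℕ.*-cancelˡ-< (suc d) k (suc c) (begin-strict
  suc d * k         ≤⟨ le ⟩
  suc d * c + d     <⟨ ℕ.+-monoʳ-< (suc d * c) (ℕ.n<1+n d) ⟩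
  suc d * c + suc d ≡⟨ ℕ.+-comm (suc d * c) (suc d) ⟩
  suc d + suc d * c ≡⟨ ℕ.*-suc (suc d) c ⟨
  suc d * suc c     ∎))
  where open ℕ.≤-Reasoning

vectors : List A → (m : ℕ) → List (Vec A m)
vectors xs zero    = [ [] ]
vectors xs (suc m) = cartesianProductWith _∷_ xs (vectors xs m)

∈-vectors : {xs : List A} → (∀ x → x ∈ xs) → (v : Vec A m) → v ∈ vectors xs m
∈-vectors complete []      = here refl
∈-vectors complete (a ∷ v) = ∈-cartesianProductWith⁺ _∷_ (complete a) (∈-vectors complete v)

vectors-unique : {xs : List A} → Unique xs → ∀ m → Unique (vectors xs m)
vectors-unique xs! zero    = [] ∷ []
vectors-unique xs! (suc m) = Unique.cartesianProductWith⁺ _∷_ Vec.∷-injective xs! (vectors-unique xs! m)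

record Finite (A : Set) : Set where
  field
    elements : List A
    complete : ∀ x → x ∈ elements

open Finite {{...}}

instance
  Bool-finite : Finite Bool
  Bool-finite = record
    { elements = false ∷ true ∷ []
    ; complete = λ { false → here refl ; true → there (here refl) }
    }

  Maybe-finite : {{Finite A}} → Finite (Maybe A)
  Maybe-finite = record
    { elements = nothing ∷ map just elements
    ; complete = λ { nothing → here refl ; (just x) → there (∈-map⁺ just (complete x)) }
    }

  ×-finite : {{Finite A}} → {{Finite B}} → Finite (A × B)
  ×-finite = record
    { elements = cartesianProduct elements elements
    ; complete = λ (x , y) → ∈-cartesianProduct⁺ (complete x) (complete y)
    }

  Vec-finite : {{Finite A}} → Finite (Vec A m)
  Vec-finite {m = m} = record { elements = vectors elements m ; complete = ∈-vectors complete }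

∀? : {{Finite A}} → {P : A → Set} → Decidable P → Dec (∀ x → P x)
∀? P? = map′ (λ ∀P x → All.lookup ∀P (complete x)) (λ ∀P → All.universal ∀P elements)
             (All.all? P? elements)

∃? : {{Finite A}} → {P : A → Set} → Decidable P → Dec (∃ P)
∃? P? = map′ Any.satisfied (λ (x , px) → lose (complete x) px) (Any.any? P? elements)

vertices-unique : ∀ n → Unique (elements {Vertex n})
vertices-unique = vectors-unique (((λ ()) All.∷ All.[]) ∷ [] ∷ [])

flip : Vertex n → Fin n → Vertex n
flip v i = v [ i ]%= not

lookup-flip : (v : Vertex n) (i : Fin n) → lookup (flip v i) i ≡ not (lookup v i)
lookup-flip v i = Vec.lookup∘updateAt i v

lookup-flip-≢ : (v : Vertex n) {i j : Fin n} → i ≢ j → lookup (flip v i) j ≡ lookup v j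
lookup-flip-≢ v {i} {j} i≢j = Vec.lookup∘updateAt′ j i (i≢j ∘ sym) v

flip-involutive : (v : Vertex n) (i : Fin n) → flip (flip v i) i ≡ v
flip-involutive v i = trans (Vec.updateAt-updateAt-local i v (Bool.not-involutive _)) (Vec.updateAt-id i v)

flip-≢ : (v : Vertex n) (i : Fin n) → v ≢ flip v i
flip-≢ v i v≡v′ = Bool.not-¬ refl (trans (cong (λ w → lookup w i) v≡v′) (lookup-flip v i))

flip-adjacent : (v : Vertex n) (i : Fin n) → Adjacent v (flip v i)
flip-adjacent (b ∷ v) zero    = here (Bool.not-¬ refl)
flip-adjacent (b ∷ v) (suc i) = there (flip-adjacent v i)

adjacent⇒flip : {a b : Vertex n} → Adjacent a b → ∃[ i ] b ≡ flip a i
adjacent⇒flip (here a≢b)  = zero , cong (_∷ _) (Bool.¬-not (a≢b ∘ sym))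
adjacent⇒flip (there a~b) with i , b≡ ← adjacent⇒flip a~b = suc i , cong (_ ∷_) b≡

-- Clearing coordinate i identifies the two endpoints of an edge in direction i.
clear : Vertex n → Fin n → Vertex n
clear v i = v [ i ]≔ false

clear-flip : (v : Vertex n) (i : Fin n) → clear (flip v i) i ≡ clear v i
clear-flip v i = Vec.updateAt-updateAt-local i v refl

clear-id : (v : Vertex n) (i : Fin n) → lookup v i ≡ false → clear v i ≡ v
clear-id v i vᵢ≡false = Vec.updateAt-id-local i v (sym vᵢ≡false)

Fits : Bool → Maybe Bool → Set
Fits a = MaybeAll.All (a ≡_)

∈Cube⇒lookup : {v : Vertex n} {p : Pattern n} → v ∈Cube p → ∀ i → Fits (lookup v i) (lookup p i)
∈Cube⇒lookup (free  v∈p) zero    = MaybeAll.nothing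
∈Cube⇒lookup (fixed v∈p) zero    = MaybeAll.just refl
∈Cube⇒lookup (free  v∈p) (suc i) = ∈Cube⇒lookup v∈p i
∈Cube⇒lookup (fixed v∈p) (suc i) = ∈Cube⇒lookup v∈p i

lookup⇒∈Cube : (v : Vertex n) (p : Pattern n) → (∀ i → Fits (lookup v i) (lookup p i)) → v ∈Cube p
lookup⇒∈Cube []      []            fits = []
lookup⇒∈Cube (a ∷ v) (nothing ∷ p) fits = free (lookup⇒∈Cube v p (fits ∘ suc))
lookup⇒∈Cube (a ∷ v) (just b ∷ p)  fits with MaybeAll.just refl ← fits zero =
  fixed (lookup⇒∈Cube v p (fits ∘ suc))

flip-∈Cube⇒free : {v : Vertex n} {p : Pattern n} (i : Fin n) →
                  v ∈Cube p → flip v i ∈Cube p → lookup p i ≡ nothing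
flip-∈Cube⇒free {v = v} {p} i v∈p v′∈p with lookup p i | ∈Cube⇒lookup v∈p i | ∈Cube⇒lookup v′∈p i
... | nothing | _ | _ = refl
... | just b  | MaybeAll.just vᵢ≡b | MaybeAll.just v′ᵢ≡b =
  ⊥-elim (Bool.not-¬ refl (trans vᵢ≡b (trans (sym v′ᵢ≡b) (lookup-flip v i))))

_∈Cube?_ : (v : Vertex n) (p : Pattern n) → Dec (v ∈Cube p)
[]      ∈Cube? []            = yes []
(a ∷ v) ∈Cube? (nothing ∷ p) = map′ free (λ { (free v∈p) → v∈p }) (v ∈Cube? p)
(a ∷ v) ∈Cube? (just b ∷ p) with a Bool.≟ b
... | yes refl = map′ fixed (λ { (fixed v∈p) → v∈p }) (v ∈Cube? p)
... | no a≢b   = no λ { (fixed _) → a≢b refl }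

corner : Pattern n → Vertex n
corner []            = []
corner (nothing ∷ p) = false ∷ corner p
corner (just b ∷ p)  = b ∷ corner p

corner-∈Cube : (p : Pattern n) → corner p ∈Cube p
corner-∈Cube []            = []
corner-∈Cube (nothing ∷ p) = free (corner-∈Cube p)
corner-∈Cube (just b ∷ p)  = fixed (corner-∈Cube p)

dim-≤ : (p : Pattern n) → dim p ≤ n
dim-≤ []            = z≤n
dim-≤ (nothing ∷ p) = s≤s (dim-≤ p)
dim-≤ (just _ ∷ p)  = ℕ.m≤n⇒m≤1+n (dim-≤ p)

dim₁ : Maybe Bool → ℕ
dim₁ x = dim (x ∷ [])

dim-sum : (p : Pattern n) → dim p ≡ ∑[ k < n ] dim₁ (lookup p k)
dim-sum []            = refl
dim-sum (nothing ∷ p) = cong suc (dim-sum p)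
dim-sum (just _ ∷ p)  = dim-sum p

-- Pairing strategies as flip-invariant direction functions

IsEdge : Edge n → Set
IsEdge e = Adjacent (proj₁ e) (proj₂ e)

EdgeIn : Pattern n → Edge n → Set
EdgeIn p e = proj₁ e ∈Cube p × proj₂ e ∈Cube p

Direction : ℕ → Set
Direction n = Vertex n → Maybe (Fin n)

FlipInvariant : Direction n → Set
FlipInvariant d = ∀ v i → d v ≡ just i → d (flip v i) ≡ just i

Covers : Direction n → Pattern n → Set
Covers d p = ∃[ v ] ∃[ i ] v ∈Cube p × flip v i ∈Cube p × d v ≡ just i

record PairingDirection (n K : ℕ) : Set where
  field
    direction : Direction n
    invariant : FlipInvariant direction
    covers    : (p : Pattern n) → dim p ≡ K → Covers direction p

module _ {d : Direction n} (invariant : FlipInvariant d) where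

  private
    -- Each edge is listed once, at its endpoint having a 0 in the matched coordinate.
    lowerEdge : Vertex n → Fin n → Bool → List (Edge n)
    lowerEdge v i false = [ v , flip v i ]
    lowerEdge v i true  = []

    edgesAt : Vertex n → List (Edge n)
    edgesAt v = maybe′ (λ i → lowerEdge v i (lookup v i)) [] (d v)

    endpointsAt : Vertex n → List (Vertex n)
    endpointsAt v = concatMap endpoints (edgesAt v)

    edgesAt-sound : ∀ {v e} → e ∈ edgesAt v → ∃[ i ] d v ≡ just i × lookup v i ≡ false × e ≡ (v , flip v i)
    edgesAt-sound {v} e∈ with d v
    ... | just i with lookup v i in vᵢ
    ...   | false with here refl ← e∈ = i , refl , vᵢ , refl

    edgesAt-complete : ∀ {v i} → d v ≡ just i → lookup v i ≡ false → (v , flip v i) ∈ edgesAt v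
    edgesAt-complete dv vᵢ rewrite dv | vᵢ = here refl

    endpointsAt-unique : ∀ v → Unique (endpointsAt v)
    endpointsAt-unique v with d v
    ... | nothing = []
    ... | just i with lookup v i
    ...   | false = (flip-≢ v i ∷ []) ∷ [] ∷ []
    ...   | true  = []

    endpointsAt-clear : ∀ {x z} → z ∈ endpointsAt x → ∃[ i ] d z ≡ just i × clear z i ≡ x
    endpointsAt-clear {x} z∈ with e , e∈ , z∈e ← find (∈-concatMap⁻ endpoints z∈)
                             with i , dx , xᵢ , refl ← edgesAt-sound {x} e∈ | z∈e
    ... | here refl         = i , dx , clear-id x i xᵢ
    ... | there (here refl) = i , invariant x i dx , trans (clear-flip x i) (clear-id x i xᵢ)

    endpointsAt-disjoint : ∀ {x y} → x ≢ y → Disjoint (endpointsAt x) (endpointsAt y)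
    endpointsAt-disjoint x≢y (z∈x , z∈y)
      with i , dz , refl ← endpointsAt-clear z∈x | j , dz′ , refl ← endpointsAt-clear z∈y
      with refl ← just-injective (trans (sym dz) dz′) = x≢y refl

  matchingOf : List (Edge n)
  matchingOf = concatMap edgesAt elements

  matchingOf-edges : All IsEdge matchingOf
  matchingOf-edges = All.tabulate λ e∈ →
    let v , _ , e∈v = find (∈-concatMap⁻ edgesAt {xs = elements} e∈)
        _ , _ , _ , e≡ = edgesAt-sound {v} e∈v
    in subst IsEdge (sym e≡) (flip-adjacent _ _)

  matchingOf-unique : Unique (concatMap endpoints matchingOf)
  matchingOf-unique = subst Unique (sym (concatMap-concatMap endpoints edgesAt elements))
    (Unique.concat⁺ (All.map⁺ (All.universal endpointsAt-unique elements))
                    (AllPairs.map⁺ (AllPairs.map endpointsAt-disjoint (vertices-unique n))))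

  matchingOf-covers : ∀ {p} → Covers d p → Any (EdgeIn p) matchingOf
  matchingOf-covers {p} (v , i , v∈p , v′∈p , dv) with lookup v i in vᵢ
  ... | false = lose (∈-concatMap⁺ edgesAt (lose (complete v) (edgesAt-complete dv vᵢ))) (v∈p , v′∈p)
  ... | true  = lose (∈-concatMap⁺ edgesAt (lose (complete (flip v i)) (edgesAt-complete (invariant v i dv) v′ᵢ)))
                     (v′∈p , subst (_∈Cube p) (sym (flip-involutive v i)) v∈p)
    where
    v′ᵢ : lookup (flip v i) i ≡ false
    v′ᵢ = trans (lookup-flip v i) (cong not vᵢ)

direction⇒pairing : ∀ {K} → PairingDirection n K → HasBreakerPairing n K
direction⇒pairing D =
  matchingOf invariant , (matchingOf-edges invariant , matchingOf-unique invariant) ,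
  λ p dp → matchingOf-covers invariant (covers p dp)
  where open PairingDirection D

axis : {a b : Vertex n} → Adjacent a b → Fin n
axis = proj₁ ∘ adjacent⇒flip

axis-flip : {a b : Vertex n} (a~b : Adjacent a b) → b ≡ flip a (axis a~b)
axis-flip = proj₂ ∘ adjacent⇒flip

flip-axis-endpoint : {a b x : Vertex n} (a~b : Adjacent a b) →
                     x ∈ endpoints (a , b) → flip x (axis a~b) ∈ endpoints (a , b)
flip-axis-endpoint         a~b (here refl)         = there (here (sym (axis-flip a~b)))
flip-axis-endpoint {a = a} a~b (there (here refl)) =
  here (trans (cong (λ w → flip w (axis a~b)) (axis-flip a~b)) (flip-involutive a (axis a~b)))

_∈?_ : (x : Vertex n) (xs : List (Vertex n)) → Dec (x ∈ xs)
x ∈? xs = Any.any? (Vec.≡-dec Bool._≟_ x) xs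

directionIn : (M : List (Edge n)) → All IsEdge M → Direction n
directionIn []      []         x = nothing
directionIn (e ∷ M) (a~b ∷ M~) x with x ∈? endpoints e
... | yes _ = just (axis a~b)
... | no  _ = directionIn M M~ x

module _ {e : Edge n} {M : List (Edge n)} (a~b : IsEdge e) (M~ : All IsEdge M) where

  directionIn-here : ∀ {x} → x ∈ endpoints e → directionIn (e ∷ M) (a~b ∷ M~) x ≡ just (axis a~b)
  directionIn-here {x} x∈e with x ∈? endpoints e
  ... | yes _  = refl
  ... | no x∉e = ⊥-elim (x∉e x∈e)

  directionIn-there : ∀ {x} → x ∉ endpoints e → directionIn (e ∷ M) (a~b ∷ M~) x ≡ directionIn M M~ x
  directionIn-there {x} x∉e with x ∈? endpoints e
  ... | yes x∈e = ⊥-elim (x∉e x∈e)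
  ... | no _    = refl

directionIn-sound : (M : List (Edge n)) (M~ : All IsEdge M) {x : Vertex n} {j : Fin n} →
                    directionIn M M~ x ≡ just j →
                    x ∈ concatMap endpoints M × flip x j ∈ concatMap endpoints M
directionIn-sound (e ∷ M) (a~b ∷ M~) {x} dx with x ∈? endpoints e
... | yes x∈e with refl ← dx = ∈-++⁺ˡ x∈e , ∈-++⁺ˡ (flip-axis-endpoint a~b x∈e)
... | no _ = let x∈M , x′∈M = directionIn-sound M M~ dx in
             ∈-++⁺ʳ (endpoints e) x∈M , ∈-++⁺ʳ (endpoints e) x′∈M

directionIn-invariant : (M : List (Edge n)) (M~ : All IsEdge M) →
                        Unique (concatMap endpoints M) → FlipInvariant (directionIn M M~)
directionIn-invariant (e ∷ M) (a~b ∷ M~) M! x j dx with x ∈? endpoints e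
... | yes x∈e with refl ← dx = directionIn-here a~b M~ (flip-axis-endpoint a~b x∈e)
... | no _ = trans (directionIn-there a~b M~ (λ x′∈e → ++-disjoint M! x′∈e x′∈M))
                   (directionIn-invariant M M~ (Unique.drop⁺ 2 M!) x j dx)
  where
  x′∈M : flip x j ∈ concatMap endpoints M
  x′∈M = proj₂ (directionIn-sound M M~ dx)

directionIn-covers : (M : List (Edge n)) (M~ : All IsEdge M) → Unique (concatMap endpoints M) →
                     ∀ {q} → Any (EdgeIn q) M → Covers (directionIn M M~) q
directionIn-covers ((a , b) ∷ M) (a~b ∷ M~) M! {q} (here (a∈q , b∈q)) =
  a , axis a~b , a∈q , subst (_∈Cube q) (axis-flip a~b) b∈q , directionIn-here a~b M~ (here refl)
directionIn-covers (e ∷ M) (a~b ∷ M~) M! (there covered) =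
  let x , j , x∈q , x′∈q , dx = directionIn-covers M M~ (Unique.drop⁺ 2 M!) covered
      x∈M = proj₁ (directionIn-sound M M~ dx)
  in x , j , x∈q , x′∈q , trans (directionIn-there a~b M~ (λ x∈e → ++-disjoint M! x∈e x∈M)) dx

pairing⇒direction : ∀ {K} → HasBreakerPairing n K → PairingDirection n K
pairing⇒direction (M , (M~ , M!) , covered) = record
  { direction = directionIn M M~
  ; invariant = directionIn-invariant M M~ M!
  ; covers    = λ q dq → directionIn-covers M M~ M! (covered q dq)
  }

-- Blocks of coordinates

module Blocks (m : ℕ) where

  -- Block i consists of the coordinates i, n + i, …, (m - 1) * n + i.
  block : Vec A (m * n) → Fin n → Vec A m
  block v i = tabulate (λ c → lookup v (combine c i))

  assemble : (Fin n → Vec A m) → Vec A (m * n)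
  assemble {n = n} β = tabulate (λ k → let c , i = remQuot {m} n k in lookup (β i) c)

  lookup-block : (v : Vec A (m * n)) (i : Fin n) (c : Fin m) → lookup (block v i) c ≡ lookup v (combine c i)
  lookup-block v i c = Vec.lookup∘tabulate _ c

  block-assemble : (β : Fin n → Vec A m) (i : Fin n) → block (assemble β) i ≡ β i
  block-assemble {n = n} β i = lookup-extensional λ c → begin
    lookup (block (assemble β) i) c
      ≡⟨ lookup-block (assemble β) i c ⟩
    lookup (assemble β) (combine c i)
      ≡⟨ Vec.lookup∘tabulate _ (combine c i) ⟩
    lookup (β (proj₂ (remQuot {m} n (combine c i)))) (proj₁ (remQuot {m} n (combine c i)))
      ≡⟨ cong (λ (c′ , i′) → lookup (β i′) c′) (Fin.remQuot-combine c i) ⟩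
    lookup (β i) c ∎
    where open ≡-Reasoning

  block-flip : (v : Vertex (m * n)) (t : Fin m) (j : Fin n) → block (flip v (combine t j)) j ≡ flip (block v j) t
  block-flip v t j = lookup-extensional λ c → trans (lookup-block (flip v (combine t j)) j c) (flipped c)
    where
    flipped : ∀ c → lookup (flip v (combine t j)) (combine c j) ≡ lookup (flip (block v j) t) c
    flipped c with t Fin.≟ c
    ... | yes refl = trans (lookup-flip v _)
                           (trans (cong not (sym (lookup-block v j t))) (sym (lookup-flip (block v j) t)))
    ... | no t≢c   = trans (lookup-flip-≢ v (t≢c ∘ proj₁ ∘ Fin.combine-injective t j c j))
                           (trans (sym (lookup-block v j c)) (sym (lookup-flip-≢ (block v j) t≢c)))

  block-flip-≢ : (v : Vertex (m * n)) (t : Fin m) {i j : Fin n} → i ≢ j →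
                 block (flip v (combine t j)) i ≡ block v i
  block-flip-≢ v t {i} {j} i≢j = lookup-extensional λ c →
    trans (lookup-block (flip v (combine t j)) i c)
          (trans (lookup-flip-≢ v (i≢j ∘ sym ∘ proj₂ ∘ Fin.combine-injective t j c i))
                 (sym (lookup-block v i c)))

  block⇒∈Cube : (v : Vertex (m * n)) (p : Pattern (m * n)) → (∀ i → block v i ∈Cube block p i) → v ∈Cube p
  block⇒∈Cube {n = n} v p blocks∈ = lookup⇒∈Cube v p λ k →
    let c , i = remQuot {m} n k in
    subst (λ k → Fits (lookup v k) (lookup p k)) (Fin.combine-remQuot {m} n k)
          (subst₂ Fits (lookup-block v i c) (lookup-block p i c) (∈Cube⇒lookup (blocks∈ i) c))

  dim-blocks : (p : Pattern (m * n)) → dim p ≡ ∑[ i < n ] dim (block p i)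
  dim-blocks {n = n} p = begin
    dim p
      ≡⟨ dim-sum p ⟩
    ∑[ k < m * n ] dim₁ (lookup p k)
      ≡⟨ ∑-combine m n _ ⟩
    ∑[ c < m ] ∑[ i < n ] dim₁ (lookup p (combine c i))
      ≡⟨ ∑-comm {m} {n} (λ c i → dim₁ (lookup p (combine c i))) ⟩
    ∑[ i < n ] ∑[ c < m ] dim₁ (lookup p (combine c i))
      ≡⟨ sum-cong-≗ (λ i → sum-cong-≗ (λ c → cong dim₁ (sym (lookup-block p i c)))) ⟩
    ∑[ i < n ] ∑[ c < m ] dim₁ (lookup (block p i) c)
      ≡⟨ sum-cong-≗ (λ i → sym (dim-sum (block p i))) ⟩
    ∑[ i < n ] dim (block p i) ∎
    where open ≡-Reasoning

-- The gadget on Q₄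

Label : Set
Label = Bool × Bool

infixl 6 _⊕_

_⊕_ : Label → Label → Label
(a , b) ⊕ (c , d) = a xor c , b xor d

𝟘 : Label
𝟘 = false , false

⊕-assoc : ∀ x y z → (x ⊕ y) ⊕ z ≡ x ⊕ (y ⊕ z)
⊕-assoc (a , b) (c , d) (e , f) = cong₂ _,_ (Bool.xor-assoc a c e) (Bool.xor-assoc b d f)

⊕-comm : ∀ x y → x ⊕ y ≡ y ⊕ x
⊕-comm (a , b) (c , d) = cong₂ _,_ (Bool.xor-comm a c) (Bool.xor-comm b d)

⊕-self : ∀ x → x ⊕ x ≡ 𝟘
⊕-self (a , b) = cong₂ _,_ (Bool.xor-same a) (Bool.xor-same b)

⊕-identityʳ : ∀ x → x ⊕ 𝟘 ≡ x
⊕-identityʳ (a , b) = cong₂ _,_ (Bool.xor-identityʳ a) (Bool.xor-identityʳ b)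

⊕-cancelʳ : ∀ x y → x ⊕ y ⊕ y ≡ x
⊕-cancelʳ x y = trans (⊕-assoc x y y) (trans (cong (x ⊕_) (⊕-self y)) (⊕-identityʳ x))

⊕-swap : ∀ x y z → x ⊕ (y ⊕ z) ≡ y ⊕ (x ⊕ z)
⊕-swap x y z = trans (sym (⊕-assoc x y z)) (trans (cong (_⊕ z) (⊕-comm x y)) (⊕-assoc y x z))

⊕-all : (Fin n → Label) → Label
⊕-all {zero}  g = 𝟘
⊕-all {suc n} g = g zero ⊕ ⊕-all (g ∘ suc)

⊕-except : Fin n → (Fin n → Label) → Label
⊕-except zero    g = ⊕-all (g ∘ suc)
⊕-except (suc j) g = g zero ⊕ ⊕-except j (g ∘ suc)

⊕-all-cong : {f g : Fin n → Label} → (∀ i → f i ≡ g i) → ⊕-all f ≡ ⊕-all g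
⊕-all-cong {zero}  eq = refl
⊕-all-cong {suc n} eq = cong₂ _⊕_ (eq zero) (⊕-all-cong (eq ∘ suc))

⊕-except-cong : (j : Fin n) {f g : Fin n → Label} → (∀ i → i ≢ j → f i ≡ g i) →
                ⊕-except j f ≡ ⊕-except j g
⊕-except-cong zero    eq = ⊕-all-cong (λ i → eq (suc i) λ ())
⊕-except-cong (suc j) eq =
  cong₂ _⊕_ (eq zero λ ()) (⊕-except-cong j (λ i i≢j → eq (suc i) (i≢j ∘ Fin.suc-injective)))

⊕-all-updateAt : (i : Fin n) (x : Label) (g : Fin n → Label) →
                 ⊕-all (updateAt g i (const x)) ≡ x ⊕ ⊕-all (updateAt g i (const 𝟘))
⊕-all-updateAt zero    x g = refl
⊕-all-updateAt (suc i) x g = trans (cong (g zero ⊕_) (⊕-all-updateAt i x (g ∘ suc))) (⊕-swap (g zero) x _)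

⊕-except-updateAt : {i j : Fin n} → i ≢ j → (x : Label) (g : Fin n → Label) →
                    ⊕-except j (updateAt g i (const x)) ≡ x ⊕ ⊕-except j (updateAt g i (const 𝟘))
⊕-except-updateAt {i = zero}  {zero}  i≢j x g = ⊥-elim (i≢j refl)
⊕-except-updateAt {i = zero}  {suc j} i≢j x g = refl
⊕-except-updateAt {i = suc i} {zero}  i≢j x g = ⊕-all-updateAt i x (g ∘ suc)
⊕-except-updateAt {i = suc i} {suc j} i≢j x g =
  trans (cong (g zero ⊕_) (⊕-except-updateAt (i≢j ∘ cong suc) x (g ∘ suc))) (⊕-swap (g zero) x _)

parity : Vec Bool m → Bool
parity []      = false
parity (b ∷ v) = b xor parity v

parity-flip : (v : Vec Bool m) (i : Fin m) → parity (flip v i) ≡ not (parity v)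
parity-flip (b ∷ v) zero    = sym (Bool.not-distribˡ-xor b (parity v))
parity-flip (b ∷ v) (suc i) = trans (cong (b xor_) (parity-flip v i)) (sym (Bool.not-distribʳ-xor b (parity v)))

label : Vec Bool 4 → Label
label (b₀ ∷ b₁ ∷ b₂ ∷ b₃ ∷ []) = b₀ xor b₂ , b₁ xor b₂

labelIndex : Label → Fin 4
labelIndex (false , false) = 0F
labelIndex (false , true)  = 1F
labelIndex (true  , false) = 2F
labelIndex (true  , true)  = 3F

-- Any table satisfying innerAxis-flip, inner-edge-in-line and inner-edge-in-plane would do.
innerAxes : Vec Bool 4 → Vec (Fin 4) 4
innerAxes (false ∷ false ∷ false ∷ false ∷ []) = 0F ∷ 1F ∷ 2F ∷ 3F ∷ []
innerAxes (true  ∷ false ∷ false ∷ false ∷ []) = 0F ∷ 3F ∷ 1F ∷ 2F ∷ []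
innerAxes (false ∷ true  ∷ false ∷ false ∷ []) = 2F ∷ 1F ∷ 3F ∷ 0F ∷ []
innerAxes (true  ∷ true  ∷ false ∷ false ∷ []) = 3F ∷ 2F ∷ 1F ∷ 0F ∷ []
innerAxes (false ∷ false ∷ true  ∷ false ∷ []) = 3F ∷ 0F ∷ 2F ∷ 1F ∷ []
innerAxes (true  ∷ false ∷ true  ∷ false ∷ []) = 1F ∷ 0F ∷ 3F ∷ 2F ∷ []
innerAxes (false ∷ true  ∷ true  ∷ false ∷ []) = 2F ∷ 3F ∷ 0F ∷ 1F ∷ []
innerAxes (true  ∷ true  ∷ true  ∷ false ∷ []) = 1F ∷ 2F ∷ 0F ∷ 3F ∷ []
innerAxes (false ∷ false ∷ false ∷ true  ∷ []) = 1F ∷ 2F ∷ 0F ∷ 3F ∷ []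
innerAxes (true  ∷ false ∷ false ∷ true  ∷ []) = 2F ∷ 3F ∷ 0F ∷ 1F ∷ []
innerAxes (false ∷ true  ∷ false ∷ true  ∷ []) = 1F ∷ 0F ∷ 3F ∷ 2F ∷ []
innerAxes (true  ∷ true  ∷ false ∷ true  ∷ []) = 3F ∷ 0F ∷ 2F ∷ 1F ∷ []
innerAxes (false ∷ false ∷ true  ∷ true  ∷ []) = 3F ∷ 2F ∷ 1F ∷ 0F ∷ []
innerAxes (true  ∷ false ∷ true  ∷ true  ∷ []) = 2F ∷ 1F ∷ 3F ∷ 0F ∷ []
innerAxes (false ∷ true  ∷ true  ∷ true  ∷ []) = 0F ∷ 3F ∷ 1F ∷ 2F ∷ []
innerAxes (true  ∷ true  ∷ true  ∷ true  ∷ []) = 0F ∷ 1F ∷ 2F ∷ 3F ∷ []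

innerAxis : Label → Vec Bool 4 → Fin 4
innerAxis s β = lookup (innerAxes β) (labelIndex s)

-- Abstract, so that uses do not re-run the exhaustive evaluation.
abstract
  innerAxis-flip : ∀ s β → innerAxis s (flip β (innerAxis s β)) ≡ innerAxis s β
  innerAxis-flip = from-yes (∀? λ s → ∀? λ β → innerAxis s (flip β (innerAxis s β)) Fin.≟ innerAxis s β)

  inner-edge-in-line : (P : Pattern 4) → 1 ≤ dim P → ∀ b →
                       ∃[ s ] ∃[ β ] β ∈Cube P × parity β ≡ b × flip β (innerAxis s β) ∈Cube P
  inner-edge-in-line = from-yes (∀? λ P → 1 ≤? dim P →-dec ∀? λ b → ∃? λ s → ∃? λ β →
    β ∈Cube? P ×-dec parity β Bool.≟ b ×-dec flip β (innerAxis s β) ∈Cube? P)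

  inner-edge-in-plane : (P : Pattern 4) → 2 ≤ dim P → ∀ s b →
                        ∃[ β ] β ∈Cube P × parity β ≡ b × flip β (innerAxis s β) ∈Cube P
  inner-edge-in-plane = from-yes (∀? λ P → 2 ≤? dim P →-dec ∀? λ s → ∀? λ b → ∃? λ β →
    β ∈Cube? P ×-dec parity β Bool.≟ b ×-dec flip β (innerAxis s β) ∈Cube? P)

  labels-in-solid : (P : Pattern 4) → 3 ≤ dim P → ∀ b s → ∃[ β ] β ∈Cube P × parity β ≡ b × label β ≡ s
  labels-in-solid = from-yes (∀? λ P → 3 ≤? dim P →-dec ∀? λ b → ∀? λ s → ∃? λ β →
    β ∈Cube? P ×-dec parity β Bool.≟ b ×-dec Product.≡-dec Bool._≟_ Bool._≟_ (label β) s)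

parity-in-line : (P : Pattern 4) → 1 ≤ dim P → ∀ b → ∃[ β ] β ∈Cube P × parity β ≡ b
parity-in-line P 1≤ b = let _ , β , β∈P , βᵖ , _ = inner-edge-in-line P 1≤ b in β , β∈P , βᵖ

-- Choosing the small subcube

indicator : Bool → ℕ
indicator true  = 1
indicator false = 0

count : (Fin n → Bool) → ℕ
count {n} F = ∑[ i < n ] indicator (F i)

count-≤ : (F : Fin n → Bool) → count F ≤ n
count-≤ {n} F = ℕ.≤-trans (∑-mono-≤ {g = λ _ → 1} (λ i → indicator≤1 (F i))) (ℕ.≤-reflexive (∑1 n))
  where
  indicator≤1 : ∀ b → indicator b ≤ 1
  indicator≤1 true  = s≤s z≤n
  indicator≤1 false = z≤n
  ∑1 : ∀ n → ∑[ i < n ] 1 ≡ n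
  ∑1 zero    = refl
  ∑1 (suc n) = cong suc (∑1 n)

subcube-within : (F : Fin n → Bool) (v : Vertex n) {b : ℕ} → b ≤ count F →
                 ∃[ q ] dim q ≡ b × v ∈Cube q × (∀ i → lookup q i ≡ nothing → T (F i))
subcube-within F []      z≤n = [] , refl , [] , λ ()
subcube-within F (x ∷ v) {zero} _ =
  let q , dq , v∈q , free⇒F = subcube-within (F ∘ suc) v z≤n in
  just x ∷ q , dq , fixed v∈q , λ { zero () ; (suc i) → free⇒F i }
subcube-within F (x ∷ v) {suc b} b≤ with F zero in F₀
... | true  = let q , dq , v∈q , free⇒F = subcube-within (F ∘ suc) v (s≤s⁻¹ b≤) in
              nothing ∷ q , cong suc dq , free v∈q , λ { zero _ → subst T (sym F₀) tt ; (suc i) → free⇒F i }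
... | false = let q , dq , v∈q , free⇒F = subcube-within (F ∘ suc) v b≤ in
              just x ∷ q , dq , fixed v∈q , λ { zero () ; (suc i) → free⇒F i }

atLeast : ℕ → (Fin n → ℕ) → Fin n → Bool
atLeast c f i = c ≤ᵇ f i

∑≤4*count : (f : Fin n → ℕ) → (∀ i → f i ≤ 4) → sum f ≤ 4 * count (atLeast 1 f)
∑≤4*count {n} f f≤4 =
  ℕ.≤-trans (∑-mono-≤ (λ i → pointwise (f i) (f≤4 i))) (ℕ.≤-reflexive (sym (*-distribˡ-sum {n} 4 _)))
  where
  pointwise : ∀ x → x ≤ 4 → x ≤ 4 * indicator (1 ≤ᵇ x)
  pointwise zero    _   = z≤n
  pointwise (suc x) x≤4 = x≤4

∑≤count+count : (f : Fin n → ℕ) → (∀ i → f i ≤ 2) → sum f ≤ count (atLeast 1 f) + count (atLeast 2 f)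
∑≤count+count {n} f f≤2 =
  ℕ.≤-trans (∑-mono-≤ (λ i → pointwise (f i) (f≤2 i))) (ℕ.≤-reflexive (∑-distrib-+ {n} _ _))
  where
  pointwise : ∀ x → x ≤ 2 → x ≤ indicator (1 ≤ᵇ x) + indicator (2 ≤ᵇ x)
  pointwise 0 _ = z≤n
  pointwise 1 _ = s≤s z≤n
  pointwise 2 _ = s≤s (s≤s z≤n)
  pointwise (suc (suc (suc _))) (s≤s (s≤s ()))

Hosting : (Fin n → ℕ) → Fin n → Set
Hosting f j = 2 ≤ f j ⊎ (1 ≤ f j × ∃[ i ] i ≢ j × 3 ≤ f i)

hosting⇒positive : {f : Fin n → ℕ} {j : Fin n} → Hosting f j → 1 ≤ f j
hosting⇒positive (inj₁ 2≤)       = ℕ.≤-trans (s≤s z≤n) 2≤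
hosting⇒positive (inj₂ (1≤ , _)) = 1≤

hosting-mask : ∀ {k} (f : Fin n → ℕ) → (∀ i → f i ≤ 4) → 4 * k ≤ sum f + 3 → n + k ≤ sum f →
               ∃[ F ] k ≤ count F × (∀ j → T (F j) → Hosting f j)
hosting-mask {n} {k} f f≤4 4k≤ n+k≤ with k ≤? count (atLeast 2 f)
... | yes k≤ = atLeast 2 f , k≤ , λ j t → inj₁ (ℕ.≤ᵇ⇒≤ 2 (f j) t)
... | no k≰ with Fin.any? (λ i → 3 ≤? f i)
...   | yes (i₀ , 3≤fᵢ₀) = atLeast 1 f , k≤count , hosting
  where
  k≤count : k ≤ count (atLeast 1 f)
  k≤count = ≤-cancel-remainder 3 (ℕ.≤-trans 4k≤ (ℕ.+-monoˡ-≤ 3 (∑≤4*count f f≤4)))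
  hosting : ∀ j → T (atLeast 1 f j) → Hosting f j
  hosting j t with 2 ≤? f j
  ... | yes 2≤fⱼ = inj₁ 2≤fⱼ
  ... | no  2≰fⱼ =
    inj₂ (ℕ.≤ᵇ⇒≤ 1 (f j) t , i₀ , (λ { refl → 2≰fⱼ (ℕ.≤-trans (ℕ.n≤1+n 2) 3≤fᵢ₀) }) , 3≤fᵢ₀)
...   | no none = ⊥-elim (ℕ.<-irrefl refl (begin-strict
  sum f                                      ≤⟨ ∑≤count+count f f≤2 ⟩
  count (atLeast 1 f) + count (atLeast 2 f)  <⟨ ℕ.+-mono-≤-< (count-≤ (atLeast 1 f)) (ℕ.≰⇒> k≰) ⟩
  n + k                                      ≤⟨ n+k≤ ⟩
  sum f                                      ∎))
  where
  open ℕ.≤-Reasoning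
  f≤2 : ∀ i → f i ≤ 2
  f≤2 i = s≤s⁻¹ (ℕ.≰⇒> (λ 3≤fᵢ → none (i , 3≤fᵢ)))

-- The blow-up from Q(n, k) to Q(4n, K)

record FibrePoint (P : Fin n → Pattern 4) (x : Vertex n) : Set where
  field
    blocks   : Fin n → Vec Bool 4
    inside   : ∀ i → blocks i ∈Cube P i
    parities : ∀ i → parity (blocks i) ≡ lookup x i

module _ {P : Fin n → Pattern 4} {x : Vertex n} where

  open FibrePoint

  replace : (w : FibrePoint P x) (i : Fin n) (β : Vec Bool 4) → β ∈Cube P i → parity β ≡ lookup x i →
            FibrePoint P x
  replace w i β β∈P βᵖ = record
    { blocks   = updateAt (blocks w) i (const β)
    ; inside   = updateAt-∀ (λ i β → β ∈Cube P i) β∈P (λ i _ → inside w i)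
    ; parities = updateAt-∀ (λ i β → parity β ≡ lookup x i) βᵖ (λ i _ → parities w i)
    }

  LiftsEdge : FibrePoint P x → Fin n → Set
  LiftsEdge w j = flip (blocks w j) (innerAxis (⊕-except j (label ∘ blocks w)) (blocks w j)) ∈Cube P j

  liftsEdge-resp : (w : FibrePoint P x) {j : Fin n} {β : Vec Bool 4} {s : Label} →
                   blocks w j ≡ β → ⊕-except j (label ∘ blocks w) ≡ s →
                   flip β (innerAxis s β) ∈Cube P j → LiftsEdge w j
  liftsEdge-resp w refl refl edge = edge

  relabel : (w : FibrePoint P x) {i₀ j : Fin n} → i₀ ≢ j → 3 ≤ dim (P i₀) → (s : Label) →
            ∃[ w′ ] blocks w′ j ≡ blocks w j × ⊕-except j (label ∘ blocks w′) ≡ s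
  relabel w {i₀} {j} i₀≢j 3≤ s =
    let β , β∈P , βᵖ , βˡ = labels-in-solid (P i₀) 3≤ (lookup x i₀) (s ⊕ rest) in
    replace w i₀ β β∈P βᵖ , VecF.updateAt-minimal j i₀ (blocks w) (i₀≢j ∘ sym) , (begin
      ⊕-except j (label ∘ updateAt (blocks w) i₀ (const β))
        ≡⟨ ⊕-except-cong j (λ i _ → VecF.map-updateAt-local {f = label} (blocks w) i₀ βˡ i) ⟩
      ⊕-except j (updateAt (label ∘ blocks w) i₀ (const (s ⊕ rest)))
        ≡⟨ ⊕-except-updateAt i₀≢j (s ⊕ rest) (label ∘ blocks w) ⟩
      s ⊕ rest ⊕ rest
        ≡⟨ ⊕-cancelʳ s rest ⟩
      s ∎)
    where
    open ≡-Reasoning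
    rest : Label
    rest = ⊕-except j (updateAt (label ∘ blocks w) i₀ (const 𝟘))

  lift-in-plane : (w : FibrePoint P x) (j : Fin n) → 2 ≤ dim (P j) → ∃[ w′ ] LiftsEdge w′ j
  lift-in-plane w j 2≤ =
    let β , β∈P , βᵖ , edge = inner-edge-in-plane (P j) 2≤ (⊕-except j (label ∘ blocks w)) (lookup x j)
        w′ = replace w j β β∈P βᵖ
    in w′ , liftsEdge-resp w′ (VecF.updateAt-updates j (blocks w))
                              (⊕-except-cong j λ i i≢j → cong label (VecF.updateAt-minimal i j (blocks w) i≢j))
                              edge

  lift-on-line : (w : FibrePoint P x) (j : Fin n) → 1 ≤ dim (P j) →
                 (i₀ : Fin n) → i₀ ≢ j → 3 ≤ dim (P i₀) → ∃[ w′ ] LiftsEdge w′ j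
  lift-on-line w j 1≤ i₀ i₀≢j 3≤ =
    let s , β , β∈P , βᵖ , edge = inner-edge-in-line (P j) 1≤ (lookup x j)
        w′ , w′ⱼ≡ , sⱼ = relabel (replace w j β β∈P βᵖ) i₀≢j 3≤ s
    in w′ , liftsEdge-resp w′ (trans w′ⱼ≡ (VecF.updateAt-updates j (blocks w))) sⱼ edge

  lift : FibrePoint P x → (j : Fin n) → Hosting (dim ∘ P) j → ∃[ w′ ] LiftsEdge w′ j
  lift w j (inj₁ 2≤)                    = lift-in-plane w j 2≤
  lift w j (inj₂ (1≤ , i₀ , i₀≢j , 3≤)) = lift-on-line w j 1≤ i₀ i₀≢j 3≤

corners : (Fin n → Pattern 4) → Vertex n
corners P = tabulate (parity ∘ corner ∘ P)

fibrePoint : (P : Fin n → Pattern 4) {x : Vertex n} {q : Pattern n} → x ∈Cube q → corners P ∈Cube q →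
             (∀ i → lookup q i ≡ nothing → 1 ≤ dim (P i)) → FibrePoint P x
fibrePoint P {x} {q} x∈q c∈q free⇒line = record
  { blocks = proj₁ ∘ choice ; inside = proj₁ ∘ proj₂ ∘ choice ; parities = proj₂ ∘ proj₂ ∘ choice }
  where
  choice : ∀ i → ∃[ β ] β ∈Cube P i × parity β ≡ lookup x i
  choice i with lookup q i in qᵢ | ∈Cube⇒lookup x∈q i | ∈Cube⇒lookup c∈q i
  ... | nothing | _ | _ = parity-in-line (P i) (free⇒line i qᵢ) (lookup x i)
  ... | just b  | MaybeAll.just xᵢ≡b | MaybeAll.just cᵢ≡b =
    corner (P i) , corner-∈Cube (P i) , trans (sym (Vec.lookup∘tabulate _ i)) (trans cᵢ≡b (sym xᵢ≡b))

module BlowUp {n k : ℕ} (D : PairingDirection n k) where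

  open PairingDirection D renaming (direction to d; invariant to d-invariant; covers to d-covers)
  open Blocks 4

  projection : Vertex (4 * n) → Vertex n
  projection v = tabulate (parity ∘ block v)

  context : Vertex (4 * n) → Fin n → Label
  context v j = ⊕-except j (label ∘ block v)

  liftedAxis : Vertex (4 * n) → Fin n → Fin (4 * n)
  liftedAxis v j = combine (innerAxis (context v j) (block v j)) j

  lifted : Direction (4 * n)
  lifted v = Maybe.map (liftedAxis v) (d (projection v))

  projection-flip : ∀ v t j → projection (flip v (combine t j)) ≡ flip (projection v) j
  projection-flip v t j = lookup-extensional λ i → trans (Vec.lookup∘tabulate _ i) (parityᵢ i)
    where
    parityᵢ : ∀ i → parity (block (flip v (combine t j)) i) ≡ lookup (flip (projection v) j) i
    parityᵢ i with i Fin.≟ j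
    ... | yes refl = begin
      parity (block (flip v (combine t i)) i) ≡⟨ cong parity (block-flip v t i) ⟩
      parity (flip (block v i) t)             ≡⟨ parity-flip (block v i) t ⟩
      not (parity (block v i))                ≡⟨ cong not (Vec.lookup∘tabulate _ i) ⟨
      not (lookup (projection v) i)           ≡⟨ lookup-flip (projection v) i ⟨
      lookup (flip (projection v) i) i        ∎
      where open ≡-Reasoning
    ... | no i≢j = trans (cong parity (block-flip-≢ v t i≢j))
                         (trans (sym (Vec.lookup∘tabulate _ i)) (sym (lookup-flip-≢ (projection v) (i≢j ∘ sym))))

  context-flip : ∀ v t j → context (flip v (combine t j)) j ≡ context v j
  context-flip v t j = ⊕-except-cong j λ i i≢j → cong label (block-flip-≢ v t i≢j)

  liftedAxis-flip : ∀ v j → liftedAxis (flip v (liftedAxis v j)) j ≡ liftedAxis v j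
  liftedAxis-flip v j = cong (λ t′ → combine t′ j) (begin
    innerAxis (context (flip v (combine t j)) j) (block (flip v (combine t j)) j)
      ≡⟨ cong₂ innerAxis (context-flip v t j) (block-flip v t j) ⟩
    innerAxis (context v j) (flip (block v j) t)
      ≡⟨ innerAxis-flip (context v j) (block v j) ⟩
    t ∎)
    where
    open ≡-Reasoning
    t : Fin 4
    t = innerAxis (context v j) (block v j)

  lifted-invariant : FlipInvariant lifted
  lifted-invariant v i dv with d (projection v) in dπv
  ... | just j with refl ← dv = begin
    Maybe.map (liftedAxis v′) (d (projection v′))
      ≡⟨ cong (Maybe.map (liftedAxis v′) ∘ d) (projection-flip v (innerAxis (context v j) (block v j)) j) ⟩
    Maybe.map (liftedAxis v′) (d (flip (projection v) j))
      ≡⟨ cong (Maybe.map (liftedAxis v′)) (d-invariant _ j dπv) ⟩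
    just (liftedAxis v′ j)
      ≡⟨ cong just (liftedAxis-flip v j) ⟩
    just (liftedAxis v j) ∎
    where
    open ≡-Reasoning
    v′ : Vertex (4 * n)
    v′ = flip v (liftedAxis v j)

  lifted-covers-by : ∀ {p x j} → d x ≡ just j → (w : FibrePoint (block p) x) → LiftsEdge w j →
                     Covers lifted p
  lifted-covers-by {p} {x} {j} dx w edge = v , liftedAxis v j , v∈p , v′∈p , cong (Maybe.map (liftedAxis v)) dπv
    where
    open FibrePoint w
    v : Vertex (4 * n)
    v = assemble blocks
    blocks≡ : ∀ i → block v i ≡ blocks i
    blocks≡ = block-assemble blocks
    dπv : d (projection v) ≡ just j
    dπv = trans (cong d (lookup-extensional λ i →
            trans (Vec.lookup∘tabulate _ i) (trans (cong parity (blocks≡ i)) (parities i)))) dx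
    v∈p : v ∈Cube p
    v∈p = block⇒∈Cube v p λ i → subst (_∈Cube block p i) (sym (blocks≡ i)) (inside i)
    t : Fin 4
    t = innerAxis (context v j) (block v j)
    flipped-blockⱼ : block (flip v (combine t j)) j ≡ flip (blocks j) (innerAxis (⊕-except j (label ∘ blocks)) (blocks j))
    flipped-blockⱼ = trans (block-flip v t j)
      (cong₂ flip (blocks≡ j) (cong₂ innerAxis (⊕-except-cong j (λ i _ → cong label (blocks≡ i))) (blocks≡ j)))
    flipped-block∈ : ∀ i → block (flip v (combine t j)) i ∈Cube block p i
    flipped-block∈ i with i Fin.≟ j
    ... | yes refl = subst (_∈Cube block p i) (sym flipped-blockⱼ) edge
    ... | no i≢j   = subst (_∈Cube block p i) (sym (trans (block-flip-≢ v t i≢j) (blocks≡ i))) (inside i)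
    v′∈p : flip v (combine t j) ∈Cube p
    v′∈p = block⇒∈Cube _ p flipped-block∈

  lifted-covers : ∀ {K} → 4 * k ≤ K + 3 → n + k ≤ K → (p : Pattern (4 * n)) → dim p ≡ K → Covers lifted p
  lifted-covers 4k≤ n+k≤ p dp =
    let ∑f≡K = trans (sym (dim-blocks {n = n} p)) dp
        F , k≤F , hosting = hosting-mask (dim ∘ block p) (dim-≤ ∘ block p)
                              (subst (λ K → 4 * k ≤ K + 3) (sym ∑f≡K) 4k≤) (subst (n + k ≤_) (sym ∑f≡K) n+k≤)
        q , dq , c∈q , free⇒F = subcube-within F (corners (block p)) k≤F
        x , j , x∈q , x′∈q , dx = d-covers q dq
        w = fibrePoint (block p) x∈q c∈q λ i qᵢ → hosting⇒positive (hosting i (free⇒F i qᵢ))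
        w′ , edge = lift w j (hosting j (free⇒F j (flip-∈Cube⇒free j x∈q x′∈q)))
    in lifted-covers-by dx w′ edge

breakerPairing-blowUp : ∀ {n k K} → HasBreakerPairing n k → 4 * k ≤ K + 3 → n + k ≤ K →
                        HasBreakerPairing (4 * n) K
breakerPairing-blowUp H 4k≤ n+k≤ = direction⇒pairing record
  { direction = lifted ; invariant = lifted-invariant ; covers = lifted-covers 4k≤ n+k≤ }
  where open BlowUp (pairing⇒direction H)

n+k≤4k∸3 : ∀ {n k} → 1 ≤ k → n ≤ 3 * k ∸ 3 → n + k ≤ 4 * k ∸ 3
n+k≤4k∸3 {n} {k} 1≤k n≤ = begin
  n + k         ≤⟨ ℕ.+-monoˡ-≤ k n≤ ⟩
  3 * k ∸ 3 + k ≡⟨ ℕ.+-∸-comm k (ℕ.*-monoʳ-≤ 3 1≤k) ⟨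
  3 * k + k ∸ 3 ≡⟨ cong (_∸ 3) (ℕ.+-comm (3 * k) k) ⟩
  4 * k ∸ 3     ∎
  where open ℕ.≤-Reasoning

4n/3≡n/3+n : ∀ n → 4 * n / 3 ≡ n / 3 + n
4n/3≡n/3+n n = trans (cong (λ m → (n + m) / 3) (ℕ.*-comm 3 n))
                     (trans (+-distrib-/-∣ʳ n (n∣m*n n)) (cong (n / 3 +_) (m*n/n≡m n 3)))

4[1+n/3]≤[1+n/3+n]+3 : ∀ n → 4 * suc (n / 3) ≤ suc (n / 3 + n) + 3
4[1+n/3]≤[1+n/3+n]+3 n = begin
  4 * suc q       ≡⟨ ℕ.*-suc 4 q ⟩
  4 + (q + 3 * q) ≤⟨ ℕ.+-monoʳ-≤ 4 (ℕ.+-monoʳ-≤ q (subst (_≤ n) (ℕ.*-comm q 3) (m/n*n≤m n 3))) ⟩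
  4 + (q + n)     ≡⟨ ℕ.+-comm 4 (q + n) ⟩
  q + n + 4       ≡⟨ ℕ.+-suc (q + n) 3 ⟩
  suc (q + n) + 3 ∎
  where
  open ℕ.≤-Reasoning
  q : ℕ
  q = n / 3

corollary3 : (n k : ℕ) → .{{_ : NonZero n}} → .{{_ : NonZero k}} →
    HasBreakerPairing n k →
    (n ≤ 3 * k ∸ 3 → HasBreakerPairing (4 * n) (4 * k ∸ 3)) ×
    (k ≡ suc (n / 3) → HasBreakerPairing (4 * n) (suc ((4 * n) / 3)))
corollary3 n k H = partA , partB
  where
  partA : n ≤ 3 * k ∸ 3 → HasBreakerPairing (4 * n) (4 * k ∸ 3)
  partA n≤ = breakerPairing-blowUp H (subst (4 * k ≤_) (ℕ.+-comm 3 _) (ℕ.m≤n+m∸n (4 * k) 3))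
                                     (n+k≤4k∸3 (>-nonZero⁻¹ k) n≤)
  partB : k ≡ suc (n / 3) → HasBreakerPairing (4 * n) (suc ((4 * n) / 3))
  partB refl = subst (HasBreakerPairing (4 * n) ∘ suc) (sym (4n/3≡n/3+n n))
    (breakerPairing-blowUp H (4[1+n/3]≤[1+n/3+n]+3 n)
                             (ℕ.≤-reflexive (trans (ℕ.+-suc n _) (cong suc (ℕ.+-comm n _)))))
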